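{- Let $n\ge 1$, $d\ge 0$, and let $G=(V,E)$ be an induced subgraph of $Q_n$. Let $G'=G\cap G_0$, where $G_0$ is the subcube $\{x\in\{0,1\}^n : x_1=0\}$. If $G'$ is non-empty and $\min_{v\in G'}\deg(v,G)\ge d$, then $|V|\ge 2^d$.
   Context: $Q_n$ is the graph with vertex set $\{0,1\}^n$ in which two vertices are adjacent iff they differ in exactly one coordinate; subgraphs are induced by their vertex sets. $G\cap G_0$ is the induced subgraph of $G$ on $V\cap V(G_0)$. $\deg(v,G)$ denotes the degree of $v$ in $G$. -}

module Defs where

open import Data.Bool using (Bool; true; false)
open import Data.Nat using (ℕ; zero; suc; _+_)
open import Data.Vec using (Vec; []; _∷_)
open import Data.List using (List; length; filter)
open import Relation.Nullary using (Dec; yes; no)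
open import Relation.Nullary.Decidable using (⌊_⌋)
open import Relation.Binary.PropositionalEquality using (_≡_)
import Data.Nat as ℕ
import Data.Bool as B

-- Vertices of Q_n : {0,1}^n encoded as Vec Bool n (false = 0, true = 1).
Vertex : ℕ → Set
Vertex n = Vec Bool n

hamming : ∀ {n} → Vertex n → Vertex n → ℕ
hamming [] [] = 0
hamming (a ∷ x) (b ∷ y) with a B.≟ b
... | yes _ = hamming x y
... | no _  = suc (hamming x y)

Adj : ∀ {n} → Vertex n → Vertex n → Set
Adj u v = hamming u v ≡ 1

adj? : ∀ {n} (u v : Vertex n) → Dec (Adj u v)
adj? u v = hamming u v ℕ.≟ 1

-- An induced subgraph of Q_n is given by its vertex set V, a duplicate-free
-- list of vertices.  deg(v, G) = number of vertices of V adjacent to v.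
deg : ∀ {n} → Vertex n → List (Vertex n) → ℕ
deg v V = length (filter (adj? v) V)

module Submission where

-- Proof idea: induction on d, by halving the vertex set along a coordinate.
-- For d = 0 a vertex of the facet already gives |V| ≥ 1.  For d + 1 take a
-- facet vertex v and a neighbour u of v in V; when d ≥ 1 the neighbour can be
-- chosen inside the facet, because v has at least two neighbours and at most
-- one of them lies across the facet's coordinate.  Let i be the coordinate in
-- which v and u differ and cut V into the halves {x_i = v_i} and {x_i = u_i}.
-- A vertex of Q_n has exactly one neighbour across coordinate i (itself with
-- bit i flipped), so degrees drop by at most one in passing to a half.  Hence
-- both halves satisfy the hypothesis for d, with v resp. u as facet vertex,
-- and induction gives 2^d vertices in each half, i.e. 2^(d+1) in V.

open import Defs
open import Data.Bool using (Bool; false; not)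
open import Data.Bool.Properties using (not-¬; ¬-not)
import Data.Bool as B
open import Data.Nat using (ℕ; zero; suc; _≤_; _^_; _+_; _*_; z≤n; s≤s; s≤s⁻¹)
open import Data.Nat.Properties
  using (≤-trans; +-suc; +-mono-≤; +-monoʳ-≤; +-comm; +-identityʳ; suc-injective; module ≤-Reasoning)
open import Data.Fin using (Fin; zero; suc)
open import Data.Vec using ([]; _∷_; head; lookup; updateAt)
open import Data.List using (List; []; _∷_; length; filter)
open import Data.List.Membership.Propositional using (_∈_)
open import Data.List.Membership.Propositional.Properties using (∈-filter⁺; ∈-filter⁻; ∈-length)
open import Data.List.Relation.Unary.Any using (here; there)
open import Data.List.Relation.Unary.All using (_∷_)
open import Data.List.Relation.Unary.AllPairs using (_∷_)
open import Data.List.Relation.Unary.Unique.Propositional using (Unique)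
open import Data.List.Relation.Unary.Unique.Propositional.Properties using (filter⁺)
open import Data.Product using (∃; _×_; _,_)
open import Data.Empty using (⊥-elim)
open import Data.Unit using (⊤; tt)
open import Function using (_∘_)
open import Level using (0ℓ)
open import Relation.Nullary using (¬_; yes; no)
open import Relation.Unary using (Pred; Decidable)
open import Relation.Binary.PropositionalEquality using (_≡_; _≢_; refl; sym; trans; cong; cong₂)

module _ {A : Set} {P Q : Pred A 0ℓ} (P? : Decidable P) (Q? : Decidable Q)
         (P⇒¬Q : ∀ {x} → P x → ¬ Q x) (¬P⇒Q : ∀ {x} → ¬ P x → Q x) where

  length-split : (xs : List A) →
    length xs ≡ length (filter P? xs) + length (filter Q? xs)
  length-split [] = refl
  length-split (x ∷ xs) with P? x | Q? x
  ... | yes p | yes q = ⊥-elim (P⇒¬Q p q)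
  ... | yes _ | no _  = cong suc (length-split xs)
  ... | no _  | yes _ = trans (cong suc (length-split xs)) (sym (+-suc _ _))
  ... | no ¬p | no ¬q = ⊥-elim (¬q (¬P⇒Q ¬p))

  count-split : {R : Pred A 0ℓ} (R? : Decidable R) (xs : List A) →
    length (filter R? xs) ≡ length (filter R? (filter P? xs)) + length (filter R? (filter Q? xs))
  count-split R? [] = refl
  count-split R? (x ∷ xs) with P? x | Q? x
  ... | yes p | yes q = ⊥-elim (P⇒¬Q p q)
  ... | no ¬p | no ¬q = ⊥-elim (¬q (¬P⇒Q ¬p))
  ... | yes _ | no _ with R? x
  ...   | yes _ = cong suc (count-split R? xs)
  ...   | no _  = count-split R? xs
  count-split R? (x ∷ xs) | no _ | yes _ with R? x
  ...   | yes _ = trans (cong suc (count-split R? xs)) (sym (+-suc _ _))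
  ...   | no _  = count-split R? xs

unique-constant-length : {A : Set} {y : A} (xs : List A) → Unique xs →
  (∀ {x} → x ∈ xs → x ≡ y) → length xs ≤ 1
unique-constant-length [] _ _ = z≤n
unique-constant-length (_ ∷ []) _ _ = s≤s z≤n
unique-constant-length (_ ∷ _ ∷ _) ((x≢x′ ∷ _) ∷ _) all-y =
  ⊥-elim (x≢x′ (trans (all-y (here refl)) (sym (all-y (there (here refl))))))

member-of-nonempty : {A : Set} (xs : List A) → 1 ≤ length xs → ∃ λ x → x ∈ xs
member-of-nonempty (x ∷ _) _ = x , here refl

flip : ∀ {n} → Fin n → Vertex n → Vertex n
flip i w = updateAt w i not

hamming-zero : ∀ {n} {x y : Vertex n} → hamming x y ≡ 0 → x ≡ y
hamming-zero {x = []} {[]} _ = refl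
hamming-zero {x = a ∷ x} {b ∷ y} h with a B.≟ b
... | yes refl = cong (a ∷_) (hamming-zero h)
hamming-zero {x = a ∷ x} {b ∷ y} () | no _

across-neighbour : ∀ {n} (i : Fin n) {w x : Vertex n} → Adj w x →
  lookup x i ≢ lookup w i → x ≡ flip i w
across-neighbour zero {a ∷ w} {b ∷ x} adj b≢a with a B.≟ b
... | yes a≡b = ⊥-elim (b≢a (sym a≡b))
... | no _    = cong₂ _∷_ (¬-not b≢a) (sym (hamming-zero (suc-injective adj)))
across-neighbour (suc i) {a ∷ w} {b ∷ x} adj xᵢ≢wᵢ with a B.≟ b
... | yes refl = cong (a ∷_) (across-neighbour i {w} {x} adj xᵢ≢wᵢ)
... | no _     = ⊥-elim (xᵢ≢wᵢ (cong (λ y → lookup y i) (sym (hamming-zero {x = w} {x} (suc-injective adj)))))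

opposite-coordinate : ∀ {n} {v u : Vertex n} → Adj v u → ∃ λ i → lookup u i ≡ not (lookup v i)
opposite-coordinate {v = []} {[]} ()
opposite-coordinate {v = a ∷ v} {b ∷ u} adj with a B.≟ b
... | no a≢b = zero , ¬-not (a≢b ∘ sym)
... | yes _  = let (i , uᵢ≡¬vᵢ) = opposite-coordinate {v = v} {u} adj in suc i , uᵢ≡¬vᵢ

Side : ∀ {n} → Fin n → Bool → Vertex n → Set
Side i b x = lookup x i ≡ b

side? : ∀ {n} (i : Fin n) (b : Bool) → Decidable (Side i b)
side? i b x = lookup x i B.≟ b

half : ∀ {n} → Fin n → Bool → List (Vertex n) → List (Vertex n)
half i b V = filter (side? i b) V

length-halves : ∀ {n} (i : Fin n) (b : Bool) (V : List (Vertex n)) →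
  length V ≡ length (half i b V) + length (half i (not b) V)
length-halves i b = length-split (side? i b) (side? i (not b)) not-¬ ¬-not

halves-bound : ∀ {n} (i : Fin n) (b : Bool) (V : List (Vertex n)) {k : ℕ} →
  k ≤ length (half i b V) → k ≤ length (half i (not b) V) → 2 * k ≤ length V
halves-bound i b V {k} k≤A k≤B = begin
  2 * k                                           ≡⟨ cong (k +_) (+-identityʳ k) ⟩
  k + k                                           ≤⟨ +-mono-≤ k≤A k≤B ⟩
  length (half i b V) + length (half i (not b) V) ≡⟨ sym (length-halves i b V) ⟩
  length V                                        ∎
  where open ≤-Reasoning

-- Restricting V to the half containing w lowers the degree of w by at most
-- one: the neighbours of w in the other half are all equal to flip i w.
degree-drop : ∀ {n} (i : Fin n) (b : Bool) (w : Vertex n) (V : List (Vertex n)) →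
  Unique V → Side i b w → deg w V ≤ suc (deg w (half i b V))
degree-drop i b w V uniq wᵢ≡b = begin
  deg w V                               ≡⟨ count-split (side? i b) (side? i (not b)) not-¬ ¬-not (adj? w) V ⟩
  deg w (half i b V) + length across    ≤⟨ +-monoʳ-≤ (deg w (half i b V)) across≤1 ⟩
  deg w (half i b V) + 1                ≡⟨ +-comm _ 1 ⟩
  suc (deg w (half i b V))              ∎
  where
  open ≤-Reasoning
  across : List (Vertex _)
  across = filter (adj? w) (half i (not b) V)

  is-flip : ∀ {x} → x ∈ across → x ≡ flip i w
  is-flip x∈ with ∈-filter⁻ (adj? w) {xs = half i (not b) V} x∈
  ... | x∈half , adj with ∈-filter⁻ (side? i (not b)) {xs = V} x∈half
  ...   | _ , xᵢ≡¬b = across-neighbour i adj (λ xᵢ≡wᵢ → not-¬ wᵢ≡b (trans (sym xᵢ≡wᵢ) xᵢ≡¬b))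

  across≤1 : length across ≤ 1
  across≤1 = unique-constant-length across (filter⁺ (adj? w) (filter⁺ (side? i (not b)) uniq)) is-flip

neighbour : ∀ {n} (v : Vertex n) (V : List (Vertex n)) → 1 ≤ deg v V → ∃ λ u → u ∈ V × Adj v u
neighbour v V 1≤deg =
  let (u , u∈) = member-of-nonempty (filter (adj? v) V) 1≤deg in u , ∈-filter⁻ (adj? v) u∈

-- A facet vertex with at least two neighbours has a neighbour inside the facet,
-- since at most one of its neighbours lies across the facet's coordinate.
facet-neighbour : ∀ {n} (j : Fin n) (c : Bool) {w : Vertex n} (V : List (Vertex n)) →
  Unique V → Side j c w → 2 ≤ deg w V → ∃ λ u → u ∈ V × Adj w u × Side j c u
facet-neighbour j c {w} V uniq wⱼ≡c 2≤deg
  with neighbour w (half j c V) (s≤s⁻¹ (≤-trans 2≤deg (degree-drop j c w V uniq wⱼ≡c)))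
... | u , u∈half , adj with ∈-filter⁻ (side? j c) {xs = V} u∈half
...   | u∈V , uⱼ≡c = u , u∈V , adj , uⱼ≡c

MinFacetDegree : ∀ {n} → Fin n → Bool → ℕ → List (Vertex n) → Set
MinFacetDegree j c d V = ∀ w → w ∈ V → Side j c w → d ≤ deg w V

half-min-degree : ∀ {n} (j : Fin n) (c : Bool) (i : Fin n) (b : Bool) {d : ℕ} {V : List (Vertex n)} →
  Unique V → MinFacetDegree j c (suc d) V → MinFacetDegree j c d (half i b V)
half-min-degree j c i b {V = V} uniq δ w w∈half wⱼ≡c with ∈-filter⁻ (side? i b) {xs = V} w∈half
... | w∈V , wᵢ≡b = s≤s⁻¹ (≤-trans (δ w w∈V wⱼ≡c) (degree-drop i b w V uniq wᵢ≡b))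

edge-split-bound : ∀ {n} {P : Pred (Vertex n) 0ℓ} {k : ℕ} {v u : Vertex n} (V : List (Vertex n)) →
  (∀ i b {x} → x ∈ half i b V → P x → k ≤ length (half i b V)) →
  Adj v u → v ∈ V → u ∈ V → P v → P u → 2 * k ≤ length V
edge-split-bound {v = v} {u} V bound adj v∈ u∈ Pv Pu with opposite-coordinate {v = v} {u} adj
... | i , uᵢ≡¬vᵢ = halves-bound i (lookup v i) V
  (bound i _ (∈-filter⁺ (side? i _) v∈ refl) Pv)
  (bound i _ (∈-filter⁺ (side? i _) u∈ uᵢ≡¬vᵢ) Pu)

-- The theorem for an arbitrary facet {x_j = c} of Q_n.  For d = 1 any edge at
-- v works; for d ≥ 2 the edge is chosen inside the facet so that induction
-- applies to both halves.
facet-bound : ∀ {n} (j : Fin n) (c : Bool) (d : ℕ) (V : List (Vertex n)) → Unique V →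
  ∀ {v} → v ∈ V → Side j c v → MinFacetDegree j c d V → 2 ^ d ≤ length V
facet-bound j c zero V _ v∈ _ _ = ∈-length v∈
facet-bound j c (suc zero) V _ {v} v∈ vⱼ≡c δ with neighbour v V (δ v v∈ vⱼ≡c)
... | u , u∈ , adj =
  edge-split-bound {P = λ _ → ⊤} V (λ _ _ x∈ _ → ∈-length x∈) adj v∈ u∈ tt tt
facet-bound j c (suc (suc d)) V uniq {v} v∈ vⱼ≡c δ =
  let (u , u∈ , adj , uⱼ≡c) = facet-neighbour j c {v} V uniq vⱼ≡c (≤-trans (s≤s (s≤s z≤n)) (δ v v∈ vⱼ≡c))
      halves-bound-by-induction = λ i b {x} (x∈ : x ∈ half i b V) (xⱼ≡c : Side j c x) →
        facet-bound j c (suc d) (half i b V) (filter⁺ (side? i b) uniq) x∈ xⱼ≡c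
          (half-min-degree j c i b {V = V} uniq δ)
  in edge-split-bound {P = Side j c} V halves-bound-by-induction adj v∈ u∈ vⱼ≡c uⱼ≡c

lookup-zero : ∀ {m} (x : Vertex (suc m)) → lookup x zero ≡ head x
lookup-zero (_ ∷ _) = refl

lemma2 : (m d : ℕ) (V : List (Vertex (suc m))) → Unique V →
    (∃ λ v → v ∈ V × head v ≡ false) →
    (∀ v → v ∈ V → head v ≡ false → d ≤ deg v V) →
    2 ^ d ≤ length V
lemma2 m d V uniq (v , v∈ , v₁≡0) δ =
  facet-bound zero false d V uniq v∈ (trans (lookup-zero v) v₁≡0)
    (λ w w∈ w₁≡0 → δ w w∈ (trans (sym (lookup-zero w)) w₁≡0))
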